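{- For $n\geq 3$, let $W_n=C_n\vee K_1$ be the wheel of order $n+1$ (a cycle $C_n$ together with one extra vertex adjacent to all vertices of the cycle). Then $pd(W_n)=2$ if $n$ is divisible by $3$, and $pd(W_n)=3$ otherwise.
   Context: All graphs are simple, finite and undirected. For an edge-coloring $c$ of a graph $G$, a set $F\subseteq E(G)$ is a proper cut if $G-F$ is disconnected and any two edges of $F$ sharing an endpoint receive different colors. A proper cut $F$ separates two vertices $x,y$ if $x$ and $y$ lie in different components of $G-F$. An edge-colored graph is proper disconnected if for every pair of distinct vertices there is a proper cut separating them. For a connected graph $G$, the proper disconnection number $pd(G)$ is the minimum $k$ such that there is an edge-coloring $c:E(G)\to\{1,\dots,k\}$ making $G$ proper disconnected. $G\vee H$ denotes the join of $G$ and $H$. -}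

module Defs where

open import Data.Nat using (ℕ; zero; suc; _≤_; _∸_; s≤s; z≤n)
open import Data.Empty using (⊥)
open import Data.Unit using (⊤; tt)
open import Data.Nat.Properties using (1+n≢n)
open import Relation.Binary.PropositionalEquality using (trans; sym)
open import Data.Fin using (Fin; toℕ) renaming (zero to fzero; suc to fsuc)
open import Data.Bool using (Bool; true; false)
open import Data.Product using (Σ; _×_; ∃; ∃-syntax; _,_)
open import Data.Sum using (_⊎_; inj₁; inj₂)
open import Relation.Binary.PropositionalEquality using (_≡_; _≢_)
open import Relation.Nullary using (¬_)

record Graph (V : ℕ) : Set₁ where
  field
    Adj     : Fin V → Fin V → Set
    symAdj  : ∀ {x y} → Adj x y → Adj y x
    irrAdj  : ∀ {x} → ¬ Adj x x
open Graph public

data Reach {V : ℕ} (A : Fin V → Fin V → Set) : Fin V → Fin V → Set where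
  here : ∀ {x} → Reach A x x
  step : ∀ {x y z} → A x y → Reach A y z → Reach A x z

Connected : ∀ {V} → Graph V → Set
Connected {V} G = ∀ (x y : Fin V) → Reach (Adj G) x y

record EdgeColoring {V : ℕ} (G : Graph V) (k : ℕ) : Set where
  field
    col    : Fin V → Fin V → Fin k
    symCol : ∀ {x y} → Adj G x y → col x y ≡ col y x
open EdgeColoring public

record EdgeSet {V : ℕ} (G : Graph V) : Set where
  field
    mem     : Fin V → Fin V → Bool
    symMem  : ∀ x y → mem x y ≡ mem y x
    subE    : ∀ {x y} → mem x y ≡ true → Adj G x y
open EdgeSet public

Minus : ∀ {V} (G : Graph V) → EdgeSet G → Fin V → Fin V → Set
Minus G F x y = Adj G x y × mem F x y ≡ false

Disconnected- : ∀ {V} (G : Graph V) → EdgeSet G → Set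
Disconnected- {V} G F = Σ (Fin V) λ x → Σ (Fin V) λ y → ¬ Reach (Minus G F) x y

ProperSet : ∀ {V k} (G : Graph V) → EdgeColoring G k → EdgeSet G → Set
ProperSet {V} G c F = ∀ (x y z : Fin V) → mem F x y ≡ true → mem F x z ≡ true →
  y ≢ z → col c x y ≢ col c x z

ProperCut : ∀ {V k} (G : Graph V) → EdgeColoring G k → EdgeSet G → Set
ProperCut G c F = Disconnected- G F × ProperSet G c F

Separates : ∀ {V} (G : Graph V) → EdgeSet G → Fin V → Fin V → Set
Separates G F x y = ¬ Reach (Minus G F) x y

ProperDisconnected : ∀ {V k} (G : Graph V) → EdgeColoring G k → Set
ProperDisconnected {V} G c = ∀ (x y : Fin V) → x ≢ y →
  Σ (EdgeSet G) λ F → ProperCut G c F × Separates G F x y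

PDColorable : ∀ {V} → Graph V → ℕ → Set
PDColorable G k = Σ (EdgeColoring G k) λ c → ProperDisconnected G c

PdIs : ∀ {V} → Graph V → ℕ → Set
PdIs G k = PDColorable G k × (∀ j → PDColorable G j → k ≤ j)

CycStep : (n : ℕ) → Fin n → Fin n → Set
CycStep n i j = (toℕ j ≡ suc (toℕ i)) ⊎ ((toℕ i ≡ n ∸ 1) × (toℕ j ≡ 0))

-- Wheel W_n = C_n ∨ K_1 on Fin (suc n): vertex 0 is the hub,
-- vertex (fsuc i) is cycle vertex i.
WheelAdj : (n : ℕ) → Fin (suc n) → Fin (suc n) → Set
WheelAdj n fzero    fzero    = ⊥
WheelAdj n fzero    (fsuc j) = ⊤
WheelAdj n (fsuc i) fzero    = ⊤
WheelAdj n (fsuc i) (fsuc j) = CycStep n i j ⊎ CycStep n j i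

wheelSym : ∀ n {x y} → WheelAdj n x y → WheelAdj n y x
wheelSym n {fzero}  {fsuc j} a = tt
wheelSym n {fsuc i} {fzero}  a = tt
wheelSym n {fsuc i} {fsuc j} (inj₁ a) = inj₂ a
wheelSym n {fsuc i} {fsuc j} (inj₂ a) = inj₁ a

cycIrr : ∀ n → 3 ≤ n → ∀ i → ¬ CycStep n i i
cycIrr n _ i (inj₁ e) = 1+n≢n (sym e)
cycIrr (suc (suc (suc n))) (s≤s (s≤s (s≤s z≤n))) i (inj₂ (e₁ , e₂)) with trans (sym e₁) e₂
... | ()

wheelIrr : ∀ n → 3 ≤ n → ∀ {x} → ¬ WheelAdj n x x
wheelIrr n h {fzero} ()
wheelIrr n h {fsuc i} (inj₁ a) = cycIrr n h i a
wheelIrr n h {fsuc i} (inj₂ a) = cycIrr n h i a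

Wheel : (n : ℕ) → 3 ≤ n → Graph (suc n)
Wheel n h = record { Adj = WheelAdj n ; symAdj = wheelSym n ; irrAdj = wheelIrr n h }

module Submission where

-- Every cut used is the boundary of a set R of rim vertices
-- (the edges leaving R), which separates any vertex of R from any vertex
-- outside.  Such a boundary is proper as soon as the cut edges meeting at each
-- vertex have distinct colours, a local condition (ProperRimSet).  With three
-- colours we colour the rim properly and give each spoke the colour missing at
-- its rim vertex; then every single rim vertex can be cut out.  With two
-- colours and 3 ∣ n we colour by residues mod 3, so that the boundaries of the
-- pairs {a, a+1} with a ≢ 0 (mod 3) are proper; they separate all pairs.
--
-- A triangle cannot be cut properly with one colour, so pd ≥ 2.
-- For a proper disconnected 2-colouring, a cut separating the hub from a rim
-- vertex must be the boundary of a rim pair {i+1, i+2}; analysing the cuts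
-- that separate the hub from a rim vertex, resp. two adjacent rim vertices,
-- shows that the rim positions where this pair boundary is not proper recur
-- with period 3.  As they also recur with period n, 3 ∣ n.

open import Defs
open import Data.Nat using (ℕ; zero; suc; _+_; _*_; _∸_; _≤_; _<_; z≤n; s≤s; _%_; _/_)
open import Data.Nat.Properties
  using (_≟_; _<?_; <⇒≢; <⇒≱; ≮⇒≥; m<n+m; +-comm; +-assoc; +-mono-<; +-cancelʳ-≡; +-cancelʳ-<;
         m∸n+n≡m; m≤n⇒m<n∨m≡n; 1+n≢0; suc-injective; ≤-refl; ≤-trans; n≤1+n)
open import Data.Nat.DivMod
  using (_mod_; m%n<n; m<n⇒m%n≡m; n%n≡0; [m+n]%n≡m%n; %-distribˡ-+; m≤n⇒[n∸m]%m≡n%m;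
         m∣n⇒o%n%m≡o%m; m≡m%n+[m/n]*n)
open import Data.Nat.Divisibility using (_∣_; m%n≡0⇒n∣m)
open import Data.Fin using (Fin; toℕ) renaming (zero to fzero; suc to fsuc)
open import Data.Fin.Properties using (toℕ-injective; toℕ<n; toℕ-fromℕ<) renaming (_≟_ to _≟ᶠ_; suc-injective to fsuc-injective)
open import Data.Bool using (Bool; true; false; _∧_; _xor_)
open import Data.Bool.Properties using (¬-not; xor-comm)
open import Data.Product using (Σ; _×_; _,_; proj₁; proj₂)
open import Data.Sum using (_⊎_; inj₁; inj₂)
open import Data.Empty using (⊥; ⊥-elim)
open import Data.Unit using (tt)
open import Relation.Nullary using (¬_; Dec; yes; no; ¬?)
open import Relation.Nullary.Decidable using (isYes; _⊎-dec_; _×-dec_)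
open import Relation.Binary.PropositionalEquality
open import Function using (_∘_)

module _ {V : ℕ} {A : Fin V → Fin V → Set} where

  reach-trans : ∀ {x y z} → Reach A x y → Reach A y z → Reach A x z
  reach-trans here       q = q
  reach-trans (step a p) q = step a (reach-trans p q)

  reach-sym : (∀ {x y} → A x y → A y x) → ∀ {x y} → Reach A x y → Reach A y x
  reach-sym s here       = here
  reach-sym s (step a p) = reach-trans (reach-sym s p) (step (s a) here)

  reach-invariant : {B : Set} (f : Fin V → B) → (∀ {x y} → A x y → f x ≡ f y) →
                    ∀ {x y} → Reach A x y → f x ≡ f y
  reach-invariant f inv here       = refl
  reach-invariant f inv (step a p) = trans (inv a) (reach-invariant f inv p)

fin2-no-three : {a b c : Fin 2} → a ≢ b → a ≢ c → b ≢ c → ⊥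
fin2-no-three {fzero}      {fzero}      a≢b _ _ = a≢b refl
fin2-no-three {fsuc fzero} {fsuc fzero} a≢b _ _ = a≢b refl
fin2-no-three {fzero}      {fsuc fzero} {fzero}      _ a≢c _ = a≢c refl
fin2-no-three {fzero}      {fsuc fzero} {fsuc fzero} _ _ b≢c = b≢c refl
fin2-no-three {fsuc fzero} {fzero}      {fzero}      _ _ b≢c = b≢c refl
fin2-no-three {fsuc fzero} {fzero}      {fsuc fzero} _ a≢c _ = a≢c refl

true≢false : true ≢ false
true≢false ()

fin1-unique : (a b : Fin 1) → a ≡ b
fin1-unique fzero fzero = refl

module Cuts {V : ℕ} (G : Graph V) where

  adj⇒≢ : ∀ {x y} → Adj G x y → x ≢ y
  adj⇒≢ a refl = irrAdj G a

  mem-sym : ∀ (F : EdgeSet G) {x y} → mem F x y ≡ true → mem F y x ≡ true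
  mem-sym F {x} {y} e = trans (symMem F y x) e

  minus-sym : ∀ (F : EdgeSet G) {x y} → Minus G F x y → Minus G F y x
  minus-sym F {x} {y} (a , e) = symAdj G a , trans (symMem F y x) e

  forced : ∀ (F : EdgeSet G) {x y u v} → Adj G x y →
           (Minus G F x y → Reach (Minus G F) u v) → ¬ Reach (Minus G F) u v →
           mem F x y ≡ true
  forced F {x} {y} a join sep with mem F x y
  ... | true  = refl
  ... | false = ⊥-elim (sep (join (a , refl)))

  two-colour-degree : (c : EdgeColoring G 2) (F : EdgeSet G) → ProperSet G c F →
    ∀ {x y z w} → y ≢ z → y ≢ w → z ≢ w →
    mem F x y ≡ true → mem F x z ≡ true → mem F x w ≡ false
  two-colour-degree c F proper {x} {y} {z} {w} y≢z y≢w z≢w xy xz with mem F x w in xw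
  ... | false = refl
  ... | true  = ⊥-elim (fin2-no-three (proper x y z xy xz y≢z)
                                      (proper x y w xy xw y≢w) (proper x z w xz xw z≢w))

  one-colour-degree : (c : EdgeColoring G 1) (F : EdgeSet G) → ProperSet G c F →
    ∀ {x y z} → y ≢ z → mem F x y ≡ true → mem F x z ≡ false
  one-colour-degree c F proper {x} {y} {z} y≢z xy with mem F x z in xz
  ... | false = refl
  ... | true  = ⊥-elim (proper x y z xy xz y≢z (fin1-unique _ _))

  -- A graph with a triangle is not proper disconnected with one colour: a cut
  -- separating x from y contains xy, hence neither xz nor yz.
  triangle-needs-two-colours : (c : EdgeColoring G 1) → ProperDisconnected G c →
    ∀ {x y z} → Adj G x y → Adj G y z → Adj G x z → ⊥
  triangle-needs-two-colours c pd {x} {y} {z} xy yz xz with pd x y (adj⇒≢ xy)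
  ... | F , (_ , proper) , sep = sep (step (xz , xz∉F) (step (symAdj G yz , zy∉F) here))
    where
      xy∈F : mem F x y ≡ true
      xy∈F = forced F xy (λ e → step e here) sep
      xz∉F : mem F x z ≡ false
      xz∉F = one-colour-degree c F proper (adj⇒≢ yz) xy∈F
      zy∉F : mem F z y ≡ false
      zy∉F = trans (symMem F z y) (one-colour-degree c F proper (adj⇒≢ xz) (mem-sym F xy∈F))

  no-zero-colouring : EdgeColoring G 0 → Fin V → ⊥
  no-zero-colouring c x with col c x x
  ... | ()

module Boundary {V : ℕ} (G : Graph V) (adj? : ∀ x y → Dec (Adj G x y)) where

  boundary : (Fin V → Bool) → EdgeSet G
  boundary S = record
    { mem    = λ x y → isYes (adj? x y) ∧ (S x xor S y)
    ; symMem = λ x y → cong₂ _∧_ (isYes-sym x y) (xor-comm (S x) (S y))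
    ; subE   = λ {x} {y} → boundary-adj x y (adj? x y)
    }
    where
      isYes-sym : ∀ x y → isYes (adj? x y) ≡ isYes (adj? y x)
      isYes-sym x y with adj? x y | adj? y x
      ... | yes _  | yes _  = refl
      ... | no _   | no _   = refl
      ... | yes a  | no ¬a  = ⊥-elim (¬a (symAdj G a))
      ... | no ¬a  | yes a  = ⊥-elim (¬a (symAdj G a))
      boundary-adj : ∀ x y (d : Dec (Adj G x y)) → isYes d ∧ (S x xor S y) ≡ true → Adj G x y
      boundary-adj x y (yes a) _ = a

  boundary-edge : ∀ S {x y} → mem (boundary S) x y ≡ true → S y ≢ S x
  boundary-edge S {x} {y} e with adj? x y | S x | S y
  boundary-edge S e | yes _ | false | true  = λ ()
  boundary-edge S e | yes _ | true  | false = λ ()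

  -- removing the boundary keeps each side closed, so the sides get separated
  boundary-separates : ∀ S {x y} → S x ≢ S y → Separates G (boundary S) x y
  boundary-separates S Sx≢Sy = Sx≢Sy ∘ reach-invariant S (λ {x} {y} → same-side x y)
    where
      same-side : ∀ x y → Minus G (boundary S) x y → S x ≡ S y
      same-side x y (a , e) with adj? x y | S x | S y
      ... | yes _ | false | false = refl
      ... | yes _ | true  | true  = refl
      ... | no ¬a | _     | _     = ⊥-elim (¬a a)

  LocallyProper : ∀ {k} → EdgeColoring G k → (Fin V → Bool) → Set
  LocallyProper c S = ∀ x y z → Adj G x y → Adj G x z → S y ≢ S x → S z ≢ S x →
                      y ≢ z → col c x y ≢ col c x z

  boundary-proper : ∀ {k} (c : EdgeColoring G k) S → LocallyProper c S →
                    ProperSet G c (boundary S)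
  boundary-proper c S local x y z xy xz =
    local x y z (subE (boundary S) xy) (subE (boundary S) xz)
          (boundary-edge S xy) (boundary-edge S xz)

  proper-disconnected-by-sides : ∀ {k} (c : EdgeColoring G k) →
    (∀ x y → x ≢ y → Σ (Fin V → Bool) λ S → LocallyProper c S × S x ≢ S y) →
    ProperDisconnected G c
  proper-disconnected-by-sides c sides x y x≢y with sides x y x≢y
  ... | S , local , Sx≢Sy = boundary S , ((x , y , sep) , boundary-proper c S local) , sep
    where sep = boundary-separates S Sx≢Sy

-- The wheel W_n for n = m + 3.  Rim position t < n is the vertex fsuc t; the
-- rim successor of position a is nx a = (a + 1) mod n.
module WheelGraph (m : ℕ) where

  n : ℕ
  n = suc (suc (suc m))

  G : Graph (suc n)
  G = Wheel n (s≤s (s≤s (s≤s z≤n)))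

  hub : Fin (suc n)
  hub = fzero

  open Cuts G

  nx : ℕ → ℕ
  nx a = suc a % n

  nx<n : ∀ a → nx a < n
  nx<n a = m%n<n (suc a) n

  rotation-moves : ∀ a d → a < n → 0 < d → d < n → (d + a) % n ≢ a
  rotation-moves a d a<n 0<d d<n e with d + a <? n
  ... | yes d+a<n = <⇒≢ (m<n+m a 0<d) (sym (trans (sym (m<n⇒m%n≡m d+a<n)) e))
  ... | no d+a≮n = <⇒≢ d<n (+-cancelʳ-≡ a d n d+a≡n+a)
    where
      n≤d+a : n ≤ d + a
      n≤d+a = ≮⇒≥ d+a≮n
      wrapped<n : d + a ∸ n < n
      wrapped<n = +-cancelʳ-< n _ n (subst (_< n + n) (sym (m∸n+n≡m n≤d+a)) (+-mono-< d<n a<n))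
      wrapped≡a : d + a ∸ n ≡ a
      wrapped≡a = trans (sym (m<n⇒m%n≡m wrapped<n)) (trans (m≤n⇒[n∸m]%m≡n%m n≤d+a) e)
      d+a≡n+a : d + a ≡ n + a
      d+a≡n+a = begin
        d + a           ≡⟨ sym (m∸n+n≡m n≤d+a) ⟩
        d + a ∸ n + n   ≡⟨ cong (_+ n) wrapped≡a ⟩
        a + n           ≡⟨ +-comm a n ⟩
        n + a           ∎
        where open ≡-Reasoning

  nx²-≡ : ∀ a → nx (nx a) ≡ suc (suc a) % n
  nx²-≡ a = sym (%-distribˡ-+ 1 (suc a) n)

  nx≢ : ∀ a → a < n → nx a ≢ a
  nx≢ a a<n = rotation-moves a 1 a<n (s≤s z≤n) (s≤s (s≤s z≤n))

  nx²≢ : ∀ a → a < n → nx (nx a) ≢ a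
  nx²≢ a a<n e = rotation-moves a 2 a<n (s≤s z≤n) (s≤s (s≤s (s≤s z≤n))) (trans (sym (nx²-≡ a)) e)

  nx-inner : ∀ {a} → suc a < n → nx a ≡ suc a
  nx-inner = m<n⇒m%n≡m

  nx-last : ∀ {a} → suc a ≡ n → nx a ≡ 0
  nx-last e = trans (cong (_% n) e) (n%n≡0 n)

  nx-inj : ∀ a b → a < n → b < n → nx a ≡ nx b → a ≡ b
  nx-inj a b a<n b<n e with m≤n⇒m<n∨m≡n a<n | m≤n⇒m<n∨m≡n b<n
  ... | inj₁ a-in | inj₁ b-in = suc-injective (trans (sym (nx-inner a-in)) (trans e (nx-inner b-in)))
  ... | inj₁ a-in | inj₂ b-last = ⊥-elim (1+n≢0 (trans (sym (nx-inner a-in)) (trans e (nx-last b-last))))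
  ... | inj₂ a-last | inj₁ b-in = ⊥-elim (1+n≢0 (trans (sym (nx-inner b-in)) (trans (sym e) (nx-last a-last))))
  ... | inj₂ a-last | inj₂ b-last = suc-injective (trans a-last (sym b-last))

  pv : ℕ → ℕ
  pv zero    = n ∸ 1
  pv (suc a) = a

  pv<n : ∀ a → a < n → pv a < n
  pv<n zero    _         = ≤-refl
  pv<n (suc a) (s≤s a<n) = ≤-trans (n≤1+n (suc a)) (s≤s a<n)

  nx-pv : ∀ a → a < n → nx (pv a) ≡ a
  nx-pv zero    _     = n%n≡0 n
  nx-pv (suc a) a+1<n = nx-inner a+1<n

  pred-unique : ∀ p t → p < n → t < n → nx p ≡ t → p ≡ pv t
  pred-unique p t p<n t<n e = nx-inj p (pv t) p<n (pv<n t t<n) (trans e (sym (nx-pv t t<n)))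

  cycStep→nx : ∀ i j → CycStep n i j → toℕ j ≡ nx (toℕ i)
  cycStep→nx i j (inj₁ j≡i+1)           = trans j≡i+1 (sym (nx-inner (subst (_< n) j≡i+1 (toℕ<n j))))
  cycStep→nx i j (inj₂ (i-last , j≡0)) = trans j≡0 (sym (nx-last (cong suc i-last)))

  nx→cycStep : ∀ i j → toℕ j ≡ nx (toℕ i) → CycStep n i j
  nx→cycStep i j e with m≤n⇒m<n∨m≡n (toℕ<n i)
  ... | inj₁ i-in   = inj₁ (trans e (nx-inner i-in))
  ... | inj₂ i-last = inj₂ (cong (_∸ 1) i-last , trans e (nx-last i-last))

  adj? : ∀ x y → Dec (WheelAdj n x y)
  adj? fzero    fzero    = no λ ()
  adj? fzero    (fsuc j) = yes tt
  adj? (fsuc i) fzero    = yes tt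
  adj? (fsuc i) (fsuc j) = cycStep? i j ⊎-dec cycStep? j i
    where
      cycStep? : ∀ i j → Dec (CycStep n i j)
      cycStep? i j = (toℕ j ≟ suc (toℕ i)) ⊎-dec ((toℕ i ≟ n ∸ 1) ×-dec (toℕ j ≟ 0))

  rim : ℕ → Fin (suc n)
  rim k = fsuc (k mod n)

  rim-pos : ∀ k → toℕ (k mod n) ≡ k % n
  rim-pos k = toℕ-fromℕ< (m%n<n k n)

  rim-pos-suc : ∀ k → toℕ (suc k mod n) ≡ nx (toℕ (k mod n))
  rim-pos-suc k = begin
    toℕ (suc k mod n)       ≡⟨ rim-pos (suc k) ⟩
    suc k % n               ≡⟨ %-distribˡ-+ 1 k n ⟩
    suc (k % n) % n         ≡⟨ cong nx (sym (rim-pos k)) ⟩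
    nx (toℕ (k mod n))      ∎
    where open ≡-Reasoning

  rim-adj : ∀ k → WheelAdj n (rim k) (rim (suc k))
  rim-adj k = inj₁ (nx→cycStep _ _ (rim-pos-suc k))

  rim-periodic : ∀ k → rim (k + n) ≡ rim k
  rim-periodic k = cong fsuc (toℕ-injective (trans (rim-pos (k + n))
                     (trans ([m+n]%n≡m%n k n) (sym (rim-pos k)))))

  -- rim vertices two steps apart are distinct since n ≥ 3
  rim-distinct₂ : ∀ k → rim k ≢ rim (suc (suc k))
  rim-distinct₂ k e = nx²≢ _ (toℕ<n (k mod n)) (sym (begin
    toℕ (k mod n)                  ≡⟨ cong toℕ (fsuc-injective e) ⟩
    toℕ (suc (suc k) mod n)        ≡⟨ rim-pos-suc (suc k) ⟩
    nx (toℕ (suc k mod n))         ≡⟨ cong nx (rim-pos-suc k) ⟩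
    nx (nx (toℕ (k mod n)))        ∎))
    where open ≡-Reasoning

  open Boundary G adj?

  data RimNeighbour (i : Fin n) : Fin (suc n) → Set where
    spoke : RimNeighbour i hub
    next  : ∀ j → toℕ j ≡ nx (toℕ i) → RimNeighbour i (fsuc j)
    prev  : ∀ j → nx (toℕ j) ≡ toℕ i → RimNeighbour i (fsuc j)

  rim-neighbour : ∀ i y → WheelAdj n (fsuc i) y → RimNeighbour i y
  rim-neighbour i fzero    _        = spoke
  rim-neighbour i (fsuc j) (inj₁ s) = next j (cycStep→nx i j s)
  rim-neighbour i (fsuc j) (inj₂ s) = prev j (sym (cycStep→nx j i s))

  -- The edge colouring with colour E a on the rim edge from a to nx a and
  -- colour Sp a on the spoke at a.
  module RimColouring {k : ℕ} (E Sp : ℕ → Fin k) where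

    -- a rim edge gets the E-colour of the endpoint it leaves in the rim order
    rimColour : ℕ → ℕ → Fin k
    rimColour a b with b ≟ nx a
    ... | yes _ = E a
    ... | no _  = E b

    rimColour-next : ∀ a b → b ≡ nx a → rimColour a b ≡ E a
    rimColour-next a b b≡nx-a with b ≟ nx a
    ... | yes _     = refl
    ... | no b≢nx-a = ⊥-elim (b≢nx-a b≡nx-a)

    rimColour-prev : ∀ a b → b < n → a ≡ nx b → rimColour a b ≡ E b
    rimColour-prev a b b<n a≡nx-b with b ≟ nx a
    ... | yes b≡nx-a = ⊥-elim (nx²≢ b b<n (trans (cong nx (sym a≡nx-b)) (sym b≡nx-a)))
    ... | no _       = refl

    colour : Fin (suc n) → Fin (suc n) → Fin k
    colour fzero    fzero    = Sp 0   -- not an edge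
    colour fzero    (fsuc j) = Sp (toℕ j)
    colour (fsuc i) fzero    = Sp (toℕ i)
    colour (fsuc i) (fsuc j) = rimColour (toℕ i) (toℕ j)

    colour-sym : ∀ {x y} → WheelAdj n x y → colour x y ≡ colour y x
    colour-sym {fzero}  {fsuc j} _ = refl
    colour-sym {fsuc i} {fzero}  _ = refl
    colour-sym {fsuc i} {fsuc j} a with rim-neighbour i (fsuc j) a
    ... | next j e = trans (rimColour-next _ _ e) (sym (rimColour-prev _ _ (toℕ<n i) e))
    ... | prev j e = trans (rimColour-prev _ _ (toℕ<n j) (sym e)) (sym (rimColour-next _ _ (sym e)))

    colouring : EdgeColoring G k
    colouring = record { col = colour ; symCol = colour-sym }

    neighbourColour : ∀ {i y} → RimNeighbour i y → Fin k
    neighbourColour {i} spoke      = Sp (toℕ i)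
    neighbourColour {i} (next _ _) = E (toℕ i)
    neighbourColour     (prev j _) = E (toℕ j)

    colour-neighbour : ∀ {i y} (nb : RimNeighbour i y) → colour (fsuc i) y ≡ neighbourColour nb
    colour-neighbour spoke      = refl
    colour-neighbour (next j e) = rimColour-next _ _ e
    colour-neighbour (prev j e) = rimColour-prev _ _ (toℕ<n j) (sym e)

    side : (ℕ → Bool) → Fin (suc n) → Bool
    side R fzero    = false
    side R (fsuc j) = R (toℕ j)

    -- The colour conditions making the boundary of R proper, listed by the
    -- vertex where two of its edges meet: the hub, a vertex of R meeting its
    -- spoke and a rim edge, or a rim vertex meeting two rim edges.
    record ProperRimSet (R : ℕ → Bool) : Set where
      field
        at-hub     : ∀ b b' → b ≢ b' → R b ≡ true → R b' ≡ true → Sp b ≢ Sp b'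
        spoke-next : ∀ t → R t ≡ true → R (nx t) ≡ false → Sp t ≢ E t
        spoke-prev : ∀ p t → p < n → t < n → nx p ≡ t → R t ≡ true → R p ≡ false → Sp t ≢ E p
        next-prev  : ∀ p t → p < n → t < n → nx p ≡ t → R (nx t) ≢ R t → R p ≢ R t → E t ≢ E p

    -- Two cut edges at the hub are spokes into R; two cut edges at a rim
    -- vertex go to neighbours of different kinds, one of the three conditions.
    rim-set-locally-proper : ∀ R → ProperRimSet R → LocallyProper colouring (side R)
    rim-set-locally-proper R cond = local
      where
        open ProperRimSet cond
        inside : ∀ {b} → b ≢ false → b ≡ true
        inside b≢false = ¬-not b≢false
        outside : ∀ {a b} → a ≢ b → b ≡ true → a ≡ false
        outside a≢b refl = ¬-not a≢b
        fsuc-≢ : ∀ {j j'} → fsuc {n} j ≢ fsuc j' → toℕ j ≢ toℕ j'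
        fsuc-≢ j≢j' e = j≢j' (cong fsuc (toℕ-injective e))

        at-rim : ∀ i {y z} (nb₁ : RimNeighbour i y) (nb₂ : RimNeighbour i z) →
                 side R y ≢ R (toℕ i) → side R z ≢ R (toℕ i) → y ≢ z →
                 neighbourColour nb₁ ≢ neighbourColour nb₂
        at-rim i spoke spoke _ _ y≢z = ⊥-elim (y≢z refl)
        at-rim i (next j e) (next j' e') _ _ y≢z = ⊥-elim (fsuc-≢ y≢z (trans e (sym e')))
        at-rim i (prev j e) (prev j' e') _ _ y≢z =
          ⊥-elim (fsuc-≢ y≢z (nx-inj _ _ (toℕ<n j) (toℕ<n j') (trans e (sym e'))))
        at-rim i spoke (next j e) oy oz _ =
          spoke-next (toℕ i) (inside (≢-sym oy)) (outside (subst (λ b → R b ≢ _) e oz) (inside (≢-sym oy)))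
        at-rim i (next j e) spoke oy oz _ =
          ≢-sym (at-rim i spoke (next j e) oz oy (λ ()))
        at-rim i spoke (prev j e) oy oz _ =
          spoke-prev (toℕ j) (toℕ i) (toℕ<n j) (toℕ<n i) e (inside (≢-sym oy)) (outside oz (inside (≢-sym oy)))
        at-rim i (prev j e) spoke oy oz _ =
          ≢-sym (at-rim i spoke (prev j e) oz oy (λ ()))
        at-rim i (next j e) (prev j' e') oy oz _ =
          next-prev (toℕ j') (toℕ i) (toℕ<n j') (toℕ<n i) e' (subst (λ b → R b ≢ _) e oy) oz
        at-rim i (prev j e) (next j' e') oy oz y≢z =
          ≢-sym (at-rim i (next j' e') (prev j e) oz oy (≢-sym y≢z))

        local : LocallyProper colouring (side R)
        local fzero    fzero    _        _ _ oy _  _   = ⊥-elim (oy refl)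
        local fzero    (fsuc j) fzero    _ _ _  oz _   = ⊥-elim (oz refl)
        local fzero    (fsuc j) (fsuc j') _ _ oy oz y≢z =
          at-hub (toℕ j) (toℕ j') (fsuc-≢ y≢z) (inside oy) (inside oz)
        local (fsuc i) y z xy xz oy oz y≢z e =
          at-rim i nb₁ nb₂ oy oz y≢z
            (trans (sym (colour-neighbour nb₁)) (trans e (colour-neighbour nb₂)))
          where
            nb₁ = rim-neighbour i y xy
            nb₂ = rim-neighbour i z xz

  -- Upper bound for all n: rim edges alternate colours 0 and 1 except the
  -- closing edge from n-1 to 0, which gets colour 2; each spoke takes a colour
  -- missing at its rim vertex.  Every rim vertex then sees three colours, so
  -- cutting out any single rim vertex is a proper cut.
  module ThreeColouring where

    parity : ℕ → Fin 3
    parity zero          = fzero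
    parity (suc zero)    = fsuc fzero
    parity (suc (suc a)) = parity a

    parity-alternates : ∀ a → parity a ≢ parity (suc a)
    parity-alternates zero          ()
    parity-alternates (suc zero)    ()
    parity-alternates (suc (suc a)) = parity-alternates a

    parity≢2 : ∀ a → parity a ≢ fsuc (fsuc fzero)
    parity≢2 zero          ()
    parity≢2 (suc zero)    ()
    parity≢2 (suc (suc a)) = parity≢2 a

    missing : (a b : Fin 3) → Σ (Fin 3) λ c → c ≢ a × c ≢ b
    missing fzero               fzero               = fsuc fzero , (λ ()) , (λ ())
    missing fzero               (fsuc fzero)        = fsuc (fsuc fzero) , (λ ()) , (λ ())
    missing fzero               (fsuc (fsuc fzero)) = fsuc fzero , (λ ()) , (λ ())
    missing (fsuc fzero)        fzero               = fsuc (fsuc fzero) , (λ ()) , (λ ())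
    missing (fsuc (fsuc fzero)) fzero               = fsuc fzero , (λ ()) , (λ ())
    missing (fsuc _)            (fsuc _)            = fzero , (λ ()) , (λ ())

    E : ℕ → Fin 3
    E a with suc a ≟ n
    ... | yes _ = fsuc (fsuc fzero)
    ... | no _  = parity a

    E-inner : ∀ a → suc a ≢ n → E a ≡ parity a
    E-inner a a+1≢n with suc a ≟ n
    ... | yes a+1≡n = ⊥-elim (a+1≢n a+1≡n)
    ... | no _      = refl

    E-last : E (n ∸ 1) ≡ fsuc (fsuc fzero)
    E-last with n ≟ n
    ... | yes _ = refl
    ... | no n≢n = ⊥-elim (n≢n refl)

    E-proper : ∀ t → t < n → E (pv t) ≢ E t
    E-proper zero _ e = parity≢2 0 (sym (trans (sym E-last) (trans e (E-inner 0 (λ ())))))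
    E-proper (suc a) a+2≤n e with suc (suc a) ≟ n
    ... | yes _ = parity≢2 a (trans (sym (E-inner a (<⇒≢ a+2≤n))) e)
    ... | no _  = parity-alternates a (trans (sym (E-inner a (<⇒≢ a+2≤n))) e)

    Sp : ℕ → Fin 3
    Sp t = proj₁ (missing (E (pv t)) (E t))

    open RimColouring E Sp public

    single : ℕ → ℕ → Bool
    single t b = isYes (b ≟ t)

    single-true : ∀ t b → single t b ≡ true → b ≡ t
    single-true t b e with b ≟ t
    ... | yes b≡t = b≡t

    single-false : ∀ t b → b ≢ t → single t b ≡ false
    single-false t b b≢t with b ≟ t
    ... | yes b≡t = ⊥-elim (b≢t b≡t)
    ... | no _    = refl

    single-proper : ∀ t → ProperRimSet (single t)
    single-proper t = record
      { at-hub     = λ b b' b≢b' Rb Rb' → ⊥-elim (b≢b' (trans (single-true t b Rb) (sym (single-true t b' Rb'))))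
      ; spoke-next = λ t _ _ → proj₂ (proj₂ (missing (E (pv t)) (E t)))
      ; spoke-prev = λ p t p<n t<n e _ _ → subst (λ q → Sp t ≢ E q) (sym (pred-unique p t p<n t<n e))
                                             (proj₁ (proj₂ (missing (E (pv t)) (E t))))
      ; next-prev  = λ p t p<n t<n e _ _ Et≡Ep →
                       E-proper t t<n (trans (cong E (sym (pred-unique p t p<n t<n e))) (sym Et≡Ep))
      }

    single-self : ∀ t → single t t ≡ true
    single-self t with t ≟ t
    ... | yes _   = refl
    ... | no t≢t = ⊥-elim (t≢t refl)

    isolated : ∀ i y → y ≢ fsuc i → side (single (toℕ i)) y ≡ false
    isolated i fzero    _ = refl
    isolated i (fsuc j) j≢i = single-false (toℕ i) (toℕ j) (λ e → j≢i (cong fsuc (toℕ-injective e)))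

    proper-disconnected : ProperDisconnected G colouring
    proper-disconnected = proper-disconnected-by-sides colouring sides
      where
        isolating-side : ∀ i → LocallyProper colouring (side (single (toℕ i)))
        isolating-side i = rim-set-locally-proper _ (single-proper (toℕ i))
        sides : ∀ x y → x ≢ y → Σ (Fin (suc n) → Bool) λ S → LocallyProper colouring S × S x ≢ S y
        sides fzero    fzero    x≢y = ⊥-elim (x≢y refl)
        sides fzero    (fsuc j) _   = side (single (toℕ j)) , isolating-side j
                                    , λ e → true≢false (sym (trans e (single-self (toℕ j))))
        sides (fsuc i) y        x≢y = side (single (toℕ i)) , isolating-side i
                                    , λ e → true≢false (trans (sym (single-self (toℕ i)))
                                                              (trans e (isolated i y (≢-sym x≢y))))

  -- Upper bound for 3 ∣ n: colours depend only on residues mod 3, which the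
  -- rim successor shifts by one since 3 ∣ n.  The boundaries of the rim pairs
  -- {a, nx a} with a ≢ 0 (mod 3) are proper cuts, and they split every pair.
  module TwoColouring (3∣n : 3 ∣ n) where

    residue : ℕ → Fin 3
    residue b = b mod 3

    rsuc : Fin 3 → Fin 3
    rsuc fzero               = fsuc fzero
    rsuc (fsuc fzero)        = fsuc (fsuc fzero)
    rsuc (fsuc (fsuc fzero)) = fzero

    toℕ-rsuc : ∀ r → toℕ (rsuc r) ≡ suc (toℕ r) % 3
    toℕ-rsuc fzero               = refl
    toℕ-rsuc (fsuc fzero)        = refl
    toℕ-rsuc (fsuc (fsuc fzero)) = refl

    residue-nx : ∀ b → residue (nx b) ≡ rsuc (residue b)
    residue-nx b = toℕ-injective (begin
      toℕ (nx b mod 3)            ≡⟨ toℕ-fromℕ< (m%n<n (nx b) 3) ⟩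
      suc b % n % 3               ≡⟨ m∣n⇒o%n%m≡o%m 3 n (suc b) 3∣n ⟩
      suc b % 3                   ≡⟨ %-distribˡ-+ 1 b 3 ⟩
      suc (b % 3) % 3             ≡⟨ cong (λ r → suc r % 3) (sym (toℕ-fromℕ< (m%n<n b 3))) ⟩
      suc (toℕ (b mod 3)) % 3     ≡⟨ sym (toℕ-rsuc (residue b)) ⟩
      toℕ (rsuc (residue b))      ∎)
      where open ≡-Reasoning

    residue-step : ∀ b {c} → nx b ≡ c → residue c ≡ rsuc (residue b)
    residue-step b refl = residue-nx b

    -- the pairs {a, nx a} used as cuts start at residue 1 or 2
    Good : ℕ → Set
    Good a = residue a ≢ fzero

    good-pv : ∀ a → a < n → residue a ≢ fsuc fzero → Good (pv a)
    good-pv a a<n r≢1 r-pv≡0 = r≢1 (trans (residue-step (pv a) (nx-pv a a<n)) (cong rsuc r-pv≡0))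

    good-nx : ∀ a → residue a ≢ fsuc (fsuc fzero) → Good (nx a)
    good-nx a r≢2 = r≢2 ∘ rsuc≡0 (residue a) ∘ trans (sym (residue-nx a))
      where
        rsuc≡0 : ∀ r → rsuc r ≡ fzero → r ≡ fsuc (fsuc fzero)
        rsuc≡0 (fsuc (fsuc fzero)) _ = refl

    e sp : Fin 3 → Fin 2
    e fzero = fsuc fzero
    e _     = fzero
    sp (fsuc (fsuc fzero)) = fsuc fzero
    sp _                   = fzero

    spokes-differ : ∀ ρ → ρ ≢ fzero → sp ρ ≢ sp (rsuc ρ)
    spokes-differ fzero               ρ≢0 = ⊥-elim (ρ≢0 refl)
    spokes-differ (fsuc fzero)        _   = λ ()
    spokes-differ (fsuc (fsuc fzero)) _   = λ ()

    spoke-next-differs : ∀ ρ → ρ ≢ fzero → sp (rsuc ρ) ≢ e (rsuc ρ)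
    spoke-next-differs fzero               ρ≢0 = ⊥-elim (ρ≢0 refl)
    spoke-next-differs (fsuc fzero)        _   = λ ()
    spoke-next-differs (fsuc (fsuc fzero)) _   = λ ()

    spoke-prev-differs : ∀ π → rsuc π ≢ fzero → sp (rsuc π) ≢ e π
    spoke-prev-differs fzero               _   = λ ()
    spoke-prev-differs (fsuc fzero)        _   = λ ()
    spoke-prev-differs (fsuc (fsuc fzero)) ρ≢0 = ⊥-elim (ρ≢0 refl)

    rim-edges-differ : ∀ τ → rsuc τ ≢ fzero → e τ ≢ e (rsuc (rsuc τ))
    rim-edges-differ fzero               _   = λ ()
    rim-edges-differ (fsuc fzero)        _   = λ ()
    rim-edges-differ (fsuc (fsuc fzero)) ρ≢0 = ⊥-elim (ρ≢0 refl)

    E Sp : ℕ → Fin 2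
    E b  = e (residue b)
    Sp b = sp (residue b)

    open RimColouring E Sp public

    In : ℕ → ℕ → Set
    In a b = b ≡ a ⊎ b ≡ nx a

    In? : ∀ a b → Dec (In a b)
    In? a b = (b ≟ a) ⊎-dec (b ≟ nx a)

    pair : ℕ → ℕ → Bool
    pair a b = isYes (In? a b)

    pair-in : ∀ {a b} → In a b → pair a b ≡ true
    pair-in {a} {b} b∈ with In? a b
    ... | yes _ = refl
    ... | no b∉ = ⊥-elim (b∉ b∈)

    pair-out : ∀ {a b} → ¬ In a b → pair a b ≡ false
    pair-out {a} {b} b∉ with In? a b
    ... | yes b∈ = ⊥-elim (b∉ b∈)
    ... | no _   = refl

    pair-true : ∀ {a b} → pair a b ≡ true → In a b
    pair-true {a} {b} e with In? a b
    ... | yes b∈ = b∈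

    differs-from-false : ∀ {b c} → b ≢ c → c ≡ false → b ≡ true
    differs-from-false b≢c refl = ¬-not b≢c

    module GoodPairCut (a : ℕ) (a<n : a < n) (good : Good a) where

      -- two cut rim edges meeting at t ∉ pair force nx t = a, p = nx a (so n = 3)
      next-prev : ∀ p t → p < n → t < n → nx p ≡ t →
                  pair a (nx t) ≢ pair a t → pair a p ≢ pair a t → E t ≢ E p
      next-prev p t p<n t<n p↦t next-out prev-out = by-cases (In? a t)
        where
          by-cases : Dec (In a t) → E t ≢ E p
          by-cases (yes (inj₁ t≡a)) =
            ⊥-elim (next-out (trans (pair-in (inj₂ (cong nx t≡a))) (sym (pair-in (inj₁ t≡a)))))
          by-cases (yes (inj₂ t≡nx-a)) =
            ⊥-elim (prev-out (trans (pair-in (inj₁ (nx-inj p a p<n a<n (trans p↦t t≡nx-a))))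
                                    (sym (pair-in (inj₂ t≡nx-a)))))
          by-cases (no t∉) Et≡Ep = rim-edges-differ (residue t) (good ∘ trans r-a) (trans Et≡Ep (cong e r-p))
            where
              t-out : pair a t ≡ false
              t-out = pair-out t∉
              t↦a : nx t ≡ a
              t↦a with pair-true (differs-from-false next-out t-out)
              ... | inj₁ t↦a     = t↦a
              ... | inj₂ t↦nx-a = ⊥-elim (t∉ (inj₁ (nx-inj t a t<n a<n t↦nx-a)))
              p≡nx-a : p ≡ nx a
              p≡nx-a with pair-true (differs-from-false prev-out t-out)
              ... | inj₂ p≡nx-a = p≡nx-a
              ... | inj₁ p≡a    = ⊥-elim (nx²≢ t t<n (trans (cong nx t↦a) (trans (cong nx (sym p≡a)) p↦t)))
              r-a : residue a ≡ rsuc (residue t)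
              r-a = residue-step t t↦a
              r-p : residue p ≡ rsuc (rsuc (residue t))
              r-p = trans (residue-step a (sym p≡nx-a)) (cong rsuc r-a)

      spokes : Sp a ≢ Sp (nx a)
      spokes = subst (λ r → sp (residue a) ≢ sp r) (sym (residue-nx a)) (spokes-differ (residue a) good)

      proper : ProperRimSet (pair a)
      proper = record
        { at-hub = at-hub ; spoke-next = spoke-next ; spoke-prev = spoke-prev ; next-prev = next-prev }
        where
          at-hub : ∀ b b' → b ≢ b' → pair a b ≡ true → pair a b' ≡ true → Sp b ≢ Sp b'
          at-hub b b' b≢b' b∈ b'∈ with pair-true b∈ | pair-true b'∈
          ... | inj₁ refl | inj₁ refl = ⊥-elim (b≢b' refl)
          ... | inj₂ refl | inj₂ refl = ⊥-elim (b≢b' refl)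
          ... | inj₁ refl | inj₂ refl = spokes
          ... | inj₂ refl | inj₁ refl = ≢-sym spokes

          spoke-next : ∀ t → pair a t ≡ true → pair a (nx t) ≡ false → Sp t ≢ E t
          spoke-next t t∈ next∉ with pair-true t∈
          ... | inj₁ refl = ⊥-elim (true≢false (trans (sym (pair-in (inj₂ refl))) next∉))
          ... | inj₂ refl = subst (λ r → sp r ≢ e r) (sym (residue-nx a)) (spoke-next-differs (residue a) good)

          spoke-prev : ∀ p t → p < n → t < n → nx p ≡ t → pair a t ≡ true → pair a p ≡ false → Sp t ≢ E p
          spoke-prev p t p<n _ p↦t t∈ p∉ with pair-true t∈
          ... | inj₁ refl = subst (λ r → sp r ≢ e (residue p)) (sym (residue-step p p↦t))
                                  (spoke-prev-differs (residue p) (good ∘ trans (residue-step p p↦t)))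
          ... | inj₂ refl = ⊥-elim (true≢false (trans (sym (pair-in (inj₁ (nx-inj p a p<n a<n p↦t)))) p∉))

    -- every rim position b lies in a good pair: {b, nx b} if b ≡ 1, else {pv b, b}
    cover : ∀ b → b < n → Σ ℕ λ a → a < n × Good a × In a b
    cover b b<n with residue b ≟ᶠ fsuc fzero
    ... | yes r≡1 = b , b<n , (λ r≡0 → 1≢0 (trans (sym r≡1) r≡0)) , inj₁ refl
      where
        1≢0 : fsuc {2} fzero ≢ fzero
        1≢0 ()
    ... | no r≢1  = pv b , pv<n b b<n , good-pv b b<n r≢1 , inj₂ (sym (nx-pv b b<n))

    Splits : ℕ → ℕ → ℕ → Set
    Splits a b b' = In a b × ¬ In a b'

    SplitBy : ℕ → ℕ → Set
    SplitBy b b' = Σ ℕ λ a → a < n × Good a × (Splits a b b' ⊎ Splits a b' b)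

    SplitBy-sym : ∀ {b b'} → SplitBy b b' → SplitBy b' b
    SplitBy-sym (a , a<n , good , inj₁ s) = a , a<n , good , inj₂ s
    SplitBy-sym (a , a<n , good , inj₂ s) = a , a<n , good , inj₁ s

    -- a and nx a are split by {nx a, nx² a} unless a ≡ 2, and then by {pv a, a}
    split-successor : ∀ a → a < n → SplitBy a (nx a)
    split-successor a a<n with residue a ≟ᶠ fsuc (fsuc fzero)
    ... | no r≢2  = nx a , nx<n a , good-nx a r≢2 , inj₂ (inj₁ refl , a∉)
      where
        a∉ : ¬ In (nx a) a
        a∉ (inj₁ a≡nx-a)  = nx≢ a a<n (sym a≡nx-a)
        a∉ (inj₂ a≡nx²-a) = nx²≢ a a<n (sym a≡nx²-a)
    ... | yes r≡2 = pv a , pv<n a a<n , good-pv a a<n (λ r≡1 → 2≢1 (trans (sym r≡2) r≡1))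
                  , inj₁ (inj₂ (sym (nx-pv a a<n)) , nx-a∉)
      where
        2≢1 : fsuc {2} (fsuc fzero) ≢ fsuc fzero
        2≢1 ()
        nx-a∉ : ¬ In (pv a) (nx a)
        nx-a∉ (inj₁ nx-a≡pv-a)    = nx²≢ a a<n (trans (cong nx nx-a≡pv-a) (nx-pv a a<n))
        nx-a∉ (inj₂ nx-a≡nx-pv-a) = nx≢ a a<n (trans nx-a≡nx-pv-a (nx-pv a a<n))

    -- distinct rim positions are split by a good pair: a pair covering b
    -- either misses b', or consists of b and b' and split-successor applies
    split : ∀ b b' → b < n → b' < n → b ≢ b' → SplitBy b b'
    split b b' b<n b'<n b≢b' with cover b b<n
    ... | a , a<n , good , b∈ with In? a b'
    ...   | no b'∉ = a , a<n , good , inj₁ (b∈ , b'∉)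
    ...   | yes b'∈ with b∈ | b'∈
    ...     | inj₁ refl | inj₁ refl = ⊥-elim (b≢b' refl)
    ...     | inj₂ refl | inj₂ refl = ⊥-elim (b≢b' refl)
    ...     | inj₁ refl | inj₂ refl = split-successor b b<n
    ...     | inj₂ refl | inj₁ refl = SplitBy-sym (split-successor b' b'<n)

    proper-disconnected : ProperDisconnected G colouring
    proper-disconnected = proper-disconnected-by-sides colouring sides
      where
        pair-side : ∀ a → a < n → Good a → LocallyProper colouring (side (pair a))
        pair-side a a<n good = rim-set-locally-proper (pair a) (GoodPairCut.proper a a<n good)
        sides : ∀ x y → x ≢ y → Σ (Fin (suc n) → Bool) λ S → LocallyProper colouring S × S x ≢ S y
        sides fzero fzero x≢y = ⊥-elim (x≢y refl)
        sides fzero (fsuc j) _ with cover (toℕ j) (toℕ<n j)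
        ... | a , a<n , good , j∈ = side (pair a) , pair-side a a<n good
                                  , λ e → true≢false (sym (trans e (pair-in j∈)))
        sides (fsuc j) fzero _ with cover (toℕ j) (toℕ<n j)
        ... | a , a<n , good , j∈ = side (pair a) , pair-side a a<n good
                                  , λ e → true≢false (trans (sym (pair-in j∈)) e)
        sides (fsuc j) (fsuc j') x≢y
          with split (toℕ j) (toℕ j') (toℕ<n j) (toℕ<n j') (λ e → x≢y (cong fsuc (toℕ-injective e)))
        ... | a , a<n , good , inj₁ (j∈ , j'∉) = side (pair a) , pair-side a a<n good
            , λ e → true≢false (trans (sym (pair-in j∈)) (trans e (pair-out j'∉)))
        ... | a , a<n , good , inj₂ (j'∈ , j∉) = side (pair a) , pair-side a a<n good
            , λ e → true≢false (trans (sym (pair-in j'∈)) (trans (sym e) (pair-out j∉)))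

  module TwoColouringLowerBound (c : EdgeColoring G 2) (pd : ProperDisconnected G c) where

    -- The boundary of the rim pair {rim (1+i), rim (2+i)} is properly coloured:
    -- its two spokes differ, and each rim edge leaving the pair differs from the
    -- spoke at its inner end.
    PairCut : ℕ → Set
    PairCut i = (col c hub (rim (1 + i)) ≢ col c hub (rim (2 + i)))
              × (col c (rim (1 + i)) (rim i) ≢ col c (rim (1 + i)) hub)
              × (col c (rim (2 + i)) (rim (3 + i)) ≢ col c (rim (2 + i)) hub)

    PairCut? : ∀ i → Dec (PairCut i)
    PairCut? i = ¬? (_ ≟ᶠ _) ×-dec ¬? (_ ≟ᶠ _) ×-dec ¬? (_ ≟ᶠ _)

    PairCut-periodic : ∀ i → PairCut (i + n) → PairCut i
    PairCut-periodic i p rewrite rim-periodic i | rim-periodic (1 + i)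
                               | rim-periodic (2 + i) | rim-periodic (3 + i) = p

    -- A proper cut F separating the hub from v = rim (2+i) is the boundary of
    -- one of the two rim pairs containing v.  The spoke hv lies in F; with two
    -- colours v has at most two cut edges, so F misses uv or vw, and following
    -- the paths the hub would otherwise use forces the remaining edges into F.
    module HubCut (i : ℕ) (F : EdgeSet G) (proper : ProperSet G c F)
                  (sep : ¬ Reach (Minus G F) hub (rim (2 + i))) where
      y u v w x : Fin (suc n)
      y = rim i
      u = rim (1 + i)
      v = rim (2 + i)
      w = rim (3 + i)
      x = rim (4 + i)

      hv : mem F hub v ≡ true
      hv = forced F tt (λ e → step e here) sep

      -- F keeps uv: then F = boundary of {u, v}
      left : mem F u v ≡ false → PairCut i
      left uv∉F = proper hub u v hu hv (adj⇒≢ (rim-adj (1 + i)))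
                , proper u y hub (mem-sym F yu) (mem-sym F hu) (λ ())
                , proper v w hub vw (mem-sym F hv) (λ ())
        where
          uv-kept : Minus G F u v
          uv-kept = rim-adj (1 + i) , uv∉F
          hu : mem F hub u ≡ true
          hu = forced F tt (λ e → step e (step uv-kept here)) sep
          hw∉F : mem F hub w ≡ false
          hw∉F = two-colour-degree c F proper (adj⇒≢ (rim-adj (1 + i))) (rim-distinct₂ (1 + i))
                                    (adj⇒≢ (rim-adj (2 + i))) hu hv
          vw : mem F v w ≡ true
          vw = forced F (rim-adj (2 + i)) (λ e → step (tt , hw∉F) (step (minus-sym F e) here)) sep
          hy∉F : mem F hub y ≡ false
          hy∉F = two-colour-degree c F proper (adj⇒≢ (rim-adj (1 + i)))
                   (≢-sym (adj⇒≢ (rim-adj i))) (≢-sym (rim-distinct₂ i)) hu hv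
          yu : mem F y u ≡ true
          yu = forced F (rim-adj i) (λ e → step (tt , hy∉F) (step e (step uv-kept here))) sep

      -- F keeps vw: then F = boundary of {v, w}
      right : mem F v w ≡ false → PairCut (1 + i)
      right vw∉F = proper hub v w hv hw (adj⇒≢ (rim-adj (2 + i)))
                 , proper v u hub (mem-sym F uv) (mem-sym F hv) (λ ())
                 , proper w x hub wx (mem-sym F hw) (λ ())
        where
          wv-kept : Minus G F w v
          wv-kept = minus-sym F (rim-adj (2 + i) , vw∉F)
          hw : mem F hub w ≡ true
          hw = forced F tt (λ e → step e (step wv-kept here)) sep
          hu∉F : mem F hub u ≡ false
          hu∉F = two-colour-degree c F proper (adj⇒≢ (rim-adj (2 + i)))
                   (≢-sym (adj⇒≢ (rim-adj (1 + i)))) (≢-sym (rim-distinct₂ (1 + i))) hv hw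
          uv : mem F u v ≡ true
          uv = forced F (rim-adj (1 + i)) (λ e → step (tt , hu∉F) (step e here)) sep
          hx∉F : mem F hub x ≡ false
          hx∉F = two-colour-degree c F proper (adj⇒≢ (rim-adj (2 + i))) (rim-distinct₂ (2 + i))
                   (adj⇒≢ (rim-adj (3 + i))) hv hw
          wx : mem F w x ≡ true
          wx = forced F (rim-adj (3 + i))
                 (λ e → step (tt , hx∉F) (step (minus-sym F e) (step wv-kept here))) sep

      pair : (PairCut i × mem F u v ≡ false) ⊎ (PairCut (1 + i) × mem F v w ≡ false)
      pair with mem F u v in uv
      ... | false = inj₁ (left uv , refl)
      ... | true  = inj₂ (right vw∉F , vw∉F)
        where
          vw∉F : mem F v w ≡ false
          vw∉F = two-colour-degree c F proper (λ ()) (λ ()) (rim-distinct₂ (1 + i))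
                   (mem-sym F hv) (mem-sym F uv)

    -- if a pair cut fails, the next pair is a proper cut (separate hub from rim (2+i))
    consecutive : ∀ i → ¬ PairCut i → PairCut (1 + i)
    consecutive i ¬Pi with pd hub (rim (2 + i)) (λ ())
    ... | F , (_ , proper) , sep with HubCut.pair i F proper sep
    ...   | inj₁ (Pi , _)   = ⊥-elim (¬Pi Pi)
    ...   | inj₂ (Pi+1 , _) = Pi+1

    -- if a pair cut fails, the pair two steps on is a proper cut
    -- (separate the adjacent rim vertices v = rim (2+i) and w = rim (3+i))
    skip : ∀ i → ¬ PairCut i → PairCut (2 + i)
    skip i ¬Pi with pd (rim (2 + i)) (rim (3 + i)) (adj⇒≢ (rim-adj (2 + i)))
    ... | F , (_ , proper) , sep = from-w-side (HubCut.pair (1 + i) F proper hub-w-separated)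
      where
        vw : mem F (rim (2 + i)) (rim (3 + i)) ≡ true
        vw = forced F (rim-adj (2 + i)) (λ e → step e here) sep
        vw-cut : ¬ mem F (rim (2 + i)) (rim (3 + i)) ≡ false
        vw-cut vw∉F = true≢false (trans (sym vw) vw∉F)
        -- if the hub reached w it would be separated from v, and every cut
        -- separating the hub from v keeps vw or contains the failed pair i
        hub-w-separated : ¬ Reach (Minus G F) hub (rim (3 + i))
        hub-w-separated hw with HubCut.pair i F proper
                                  (λ hv → sep (reach-trans (reach-sym (minus-sym F) hv) hw))
        ... | inj₁ (Pi , _)   = ¬Pi Pi
        ... | inj₂ (_ , vw∉F) = vw-cut vw∉F
        from-w-side : (PairCut (1 + i) × mem F (rim (2 + i)) (rim (3 + i)) ≡ false)
                    ⊎ (PairCut (2 + i) × mem F (rim (3 + i)) (rim (4 + i)) ≡ false) → PairCut (2 + i)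
        from-w-side (inj₁ (_ , vw∉F)) = ⊥-elim (vw-cut vw∉F)
        from-w-side (inj₂ (Pi+2 , _)) = Pi+2

    -- three consecutive pair cuts cannot all be proper: the triangle
    -- hub, rim (2+i), rim (3+i) would carry three different colours
    no-three-consecutive : ∀ i → PairCut i → PairCut (1 + i) → PairCut (2 + i) → ⊥
    no-three-consecutive i (_ , _ , vw≢vh) (hv≢hw , _ , _) (_ , wv≢wh , _) =
      fin2-no-three {col c v w} {col c hub v} {col c hub w}
        (λ e → vw≢vh (trans e (symCol c tt)))
        (λ e → wv≢wh (trans (sym (symCol c (rim-adj (2 + i)))) (trans e (symCol c tt))))
        hv≢hw
      where
        v w : Fin (suc n)
        v = rim (2 + i)
        w = rim (3 + i)

    fail-step : ∀ i → ¬ PairCut i → ¬ PairCut (3 + i)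
    fail-step i ¬Pi = no-three-consecutive (1 + i) (consecutive i ¬Pi) (skip i ¬Pi)

    fail-periodic : ∀ k i → ¬ PairCut i → ¬ PairCut (k * 3 + i)
    fail-periodic zero    i ¬Pi = ¬Pi
    fail-periodic (suc k) i ¬Pi = fail-step (k * 3 + i) (fail-periodic k i ¬Pi)

    some-failure : Σ ℕ λ i → ¬ PairCut i
    some-failure with PairCut? 0 | PairCut? 1 | PairCut? 2
    ... | no ¬P0 | _      | _      = 0 , ¬P0
    ... | yes _  | no ¬P1 | _      = 1 , ¬P1
    ... | yes _  | yes _  | no ¬P2 = 2 , ¬P2
    ... | yes P0 | yes P1 | yes P2 = ⊥-elim (no-three-consecutive 0 P0 P1 P2)

    -- A failure at i₀ recurs at i₀ + 3q, q = n / 3; if n % 3 were 1 or 2,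
    -- consecutive resp. skip would make the cut at i₀ + n, i.e. at i₀, proper.
    three-divides : 3 ∣ n
    three-divides with some-failure
    ... | i₀ , ¬P₀ = m%n≡0⇒n∣m n 3 (residue-zero (n % 3) refl)
      where
        q = n / 3
        ¬Pq : ¬ PairCut (q * 3 + i₀)
        ¬Pq = fail-periodic q i₀ ¬P₀
        wrap : ∀ r → n % 3 ≡ r → r + (q * 3 + i₀) ≡ i₀ + n
        wrap r e = begin
          r + (q * 3 + i₀)     ≡⟨ sym (+-assoc r (q * 3) i₀) ⟩
          r + q * 3 + i₀       ≡⟨ cong (λ s → s + q * 3 + i₀) (sym e) ⟩
          n % 3 + q * 3 + i₀   ≡⟨ cong (_+ i₀) (sym (m≡m%n+[m/n]*n n 3)) ⟩
          n + i₀               ≡⟨ +-comm n i₀ ⟩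
          i₀ + n               ∎
          where open ≡-Reasoning
        back-to-start : ∀ r → n % 3 ≡ r → PairCut (r + (q * 3 + i₀)) → ⊥
        back-to-start r e P = ¬P₀ (PairCut-periodic i₀ (subst PairCut (wrap r e) P))
        residue-zero : ∀ r → n % 3 ≡ r → r ≡ 0
        residue-zero 0 _ = refl
        residue-zero 1 e = ⊥-elim (back-to-start 1 e (consecutive _ ¬Pq))
        residue-zero 2 e = ⊥-elim (back-to-start 2 e (skip _ ¬Pq))
        residue-zero (suc (suc (suc r))) e = ⊥-elim (<⇒≱ (m%n<n n 3) (subst (3 ≤_) (sym e) (s≤s (s≤s (s≤s z≤n)))))

  -- The hub with two consecutive rim vertices is a triangle, so pd ≥ 2.
  at-least-two : ∀ k → PDColorable G k → 2 ≤ k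
  at-least-two zero          (c , _)  = ⊥-elim (no-zero-colouring c hub)
  at-least-two (suc zero)    (c , pd) = ⊥-elim (triangle-needs-two-colours c pd {hub} tt (rim-adj 0) tt)
  at-least-two (suc (suc k)) _        = s≤s (s≤s z≤n)

  -- With two colours 3 ∣ n, so otherwise pd ≥ 3.
  at-least-three : ¬ 3 ∣ n → ∀ k → PDColorable G k → 3 ≤ k
  at-least-three 3∤n (suc (suc zero))    (c , pd) = ⊥-elim (3∤n (TwoColouringLowerBound.three-divides c pd))
  at-least-three 3∤n (suc (suc (suc k))) _        = s≤s (s≤s (s≤s z≤n))
  at-least-three 3∤n k@zero              pdk with at-least-two k pdk
  ... | ()
  at-least-three 3∤n k@(suc zero)        pdk with at-least-two k pdk
  ... | s≤s ()

theorem3p2 : (n : ℕ) → (h : 3 ≤ n) →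
    (3 ∣ n → PdIs (Wheel n h) 2) × (¬ (3 ∣ n) → PdIs (Wheel n h) 3)
theorem3p2 (suc (suc (suc m))) (s≤s (s≤s (s≤s z≤n))) =
    (λ 3∣n → (TwoColouring.colouring 3∣n , TwoColouring.proper-disconnected 3∣n) , at-least-two)
  , (λ 3∤n → (ThreeColouring.colouring , ThreeColouring.proper-disconnected) , at-least-three 3∤n)
  where open WheelGraph m
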